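{- Let $L$ be a Latin square of order $n$ and let $L_3(L,n)$ be its Latin square graph. Then $\gamma_{3}(L_3(L,n))\geq n$.
   Context: A Latin square of order $n$ is an $n\times n$ array $L=(\ell_{i,j})$ with entries from $[n]=\{1,\dots,n\}$ such that no symbol appears twice in any row or column. Its Latin square graph $L_3(L,n)$ has vertex set $\{(i,j)\mid 1\le i,j\le n\}$, and two distinct vertices $(i,j)$ and $(p,q)$ are adjacent iff $i=p$ or $j=q$ or $\ell_{i,j}=\ell_{p,q}$. For a positive integer $k$, a subset $S$ of the vertex set $V$ of a graph $G$ is a $k$-dominating set if every vertex $v\in V\setminus S$ has at least $k$ neighbours in $S$; the $k$-domination number $\gamma_k(G)$ is the minimum cardinality of a $k$-dominating set of $G$. -}

module Defs where

open import Data.Nat using (ℕ; _≤_)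
open import Data.Fin using (Fin)
open import Data.Fin.Properties using (_≟_)
open import Data.Product using (_×_; _,_)
open import Data.Sum using (_⊎_)
open import Data.List using (List; length; filter)
open import Data.List.Membership.Propositional using (_∈_; _∉_)
open import Data.List.Relation.Unary.Unique.Propositional using (Unique)
open import Relation.Binary.PropositionalEquality using (_≡_; _≢_)
open import Relation.Nullary using (¬_; Dec)
open import Relation.Nullary.Decidable using (_⊎-dec_; _×-dec_; ¬?)
open import Data.Product.Properties using (≡-dec)
open import Function.Definitions using (Injective)

LatinSquare : ℕ → Set
LatinSquare n = Fin n → Fin n → Fin n

IsLatin : {n : ℕ} → LatinSquare n → Set
IsLatin {n} L =
  (∀ i → Injective _≡_ _≡_ (λ j → L i j)) ×
  (∀ j → Injective _≡_ _≡_ (λ i → L i j))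

Vertex : ℕ → Set
Vertex n = Fin n × Fin n

Adj : {n : ℕ} → LatinSquare n → Vertex n → Vertex n → Set
Adj L (i , j) (p , q) =
  ¬ ((i , j) ≡ (p , q)) × (i ≡ p ⊎ j ≡ q ⊎ L i j ≡ L p q)

adj? : {n : ℕ} (L : LatinSquare n) (u v : Vertex n) → Dec (Adj L u v)
adj? L (i , j) (p , q) =
  ¬? (≡-dec _≟_ _≟_ (i , j) (p , q)) ×-dec
  (i ≟ p ⊎-dec (j ≟ q ⊎-dec (L i j ≟ L p q)))

neighboursIn : {n : ℕ} → LatinSquare n → List (Vertex n) → Vertex n → ℕ
neighboursIn L S v = length (filter (adj? L v) S)

IsKDominating : {n : ℕ} → LatinSquare n → ℕ → List (Vertex n) → Set
IsKDominating L k S = ∀ v → v ∉ S → k ≤ neighboursIn L S v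

module Submission where

-- Either every row of the square contains a vertex of S, and
-- then choosing one such vertex per row is an injection of the n rows
-- into S; or some row r contains no vertex of S.  In the second case
-- all n vertices (r , j) lie outside S, so each has at least 3
-- neighbours in S, and summing over j gives  3n ≤ Σⱼ |N(r , j) ∩ S|.
-- On the other hand a vertex s = (p , q) with p ≢ r is adjacent to at
-- most two vertices of row r: the one in its column q and the one
-- carrying its symbol (the symbols along a row are distinct).  Counting
-- the same adjacencies from the side of S therefore gives
-- Σⱼ |N(r , j) ∩ S| ≤ 2|S|, and 3n ≤ 2|S| forces n ≤ |S|.

open import Defs
open import Data.Nat using (ℕ; zero; suc; _+_; _*_; _≤_; z≤n; s≤s)
open import Data.Nat.Properties
  using (+-0-commutativeMonoid; +-mono-≤; ≤-trans; ≤-reflexive; m≤n+m; *-monoʳ-≤; *-cancelʳ-≤; module ≤-Reasoning)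
open import Data.Fin using (Fin; zero; suc)
open import Data.Fin.Properties using (_≟_; injective⇒≤; all?; ¬∀⟶∃¬; suc-injective)
open import Data.Product using (_,_; proj₁)
open import Data.Sum using (inj₁; inj₂)
open import Data.Empty using (⊥-elim)
open import Data.List using (List; []; _∷_; length; lookup)
open import Data.List.Properties using (filter-accept; filter-reject)
open import Data.List.Relation.Unary.Any as Any using (index; any?)
open import Data.List.Relation.Unary.Any.Properties using (lookup-index)
open import Data.List.Relation.Unary.All using (All; []; _∷_)
open import Data.List.Relation.Unary.All.Properties using (¬Any⇒All¬)
open import Data.List.Relation.Unary.Unique.Propositional using (Unique)
open import Data.List.Membership.Propositional using (_∉_)
open import Function.Base using (_∘_)
open import Function.Definitions using (Injective)
open import Relation.Nullary using (Dec; yes; no)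
open import Relation.Binary.Definitions using (DecidableEquality)
open import Relation.Binary.PropositionalEquality
  using (_≡_; _≢_; refl; sym; trans; cong)
open import Algebra.Properties.CommutativeMonoid.Sum +-0-commutativeMonoid
  using (sum; sum-cong-≗; ∑-distrib-+)

𝟙 : ∀ {p} {P : Set p} → Dec P → ℕ
𝟙 (yes _) = 1
𝟙 (no _)  = 0

sum-mono : ∀ {n} {f g : Fin n → ℕ} → (∀ i → f i ≤ g i) → sum f ≤ sum g
sum-mono {zero}  f≤g = z≤n
sum-mono {suc n} f≤g = +-mono-≤ (f≤g zero) (sum-mono (λ i → f≤g (suc i)))

sum-lowerBound : ∀ {n} (c : ℕ) {f : Fin n → ℕ} → (∀ i → c ≤ f i) → n * c ≤ sum f
sum-lowerBound {zero}  c c≤f = z≤n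
sum-lowerBound {suc n} c c≤f = +-mono-≤ (c≤f zero) (sum-lowerBound c (λ i → c≤f (suc i)))

sum-zero : ∀ {n} {f : Fin n → ℕ} → (∀ i → f i ≡ 0) → sum f ≡ 0
sum-zero {zero}  f≡0 = refl
sum-zero {suc n} {f} f≡0
  rewrite f≡0 zero | sum-zero {f = λ i → f (suc i)} (λ i → f≡0 (suc i)) = refl

hits-injective≤1 : ∀ {a} {A : Set a} (_≟ᴬ_ : DecidableEquality A) {n}
  (g : Fin n → A) → Injective _≡_ _≡_ g → ∀ x → sum (λ i → 𝟙 (g i ≟ᴬ x)) ≤ 1
hits-injective≤1 _≟ᴬ_ {zero} g g-inj x = z≤n
hits-injective≤1 _≟ᴬ_ {suc n} g g-inj x with g zero ≟ᴬ x
... | yes g0≡x = s≤s (≤-reflexive (sum-zero noOtherHit))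
  where
  noOtherHit : ∀ i → 𝟙 (g (suc i) ≟ᴬ x) ≡ 0
  noOtherHit i with g (suc i) ≟ᴬ x
  ... | yes gi≡x with () ← g-inj (trans gi≡x (sym g0≡x))
  ... | no _ = refl
... | no _ = hits-injective≤1 _≟ᴬ_ (λ i → g (suc i)) (λ e → suc-injective (g-inj e)) x

neighboursIn-∷ : ∀ {n} (L : LatinSquare n) (s : Vertex n) (S : List (Vertex n)) v →
  neighboursIn L (s ∷ S) v ≡ 𝟙 (adj? L v s) + neighboursIn L S v
neighboursIn-∷ L s S v with adj? L v s
... | yes v~s = cong length (filter-accept (adj? L v) v~s)
... | no  v≁s = cong length (filter-reject (adj? L v) v≁s)

-- If every row index is the row of some element of S, then S has at
-- least n elements: sending a row to the position of such an element
-- is injective.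
rowsCovered⇒n≤length : ∀ {n} (S : List (Vertex n)) →
  (∀ r → Any.Any (λ s → proj₁ s ≡ r) S) → n ≤ length S
rowsCovered⇒n≤length {n} S covered = injective⇒≤ position-injective
  where
  position : Fin n → Fin (length S)
  position r = index (covered r)
  position-injective : Injective _≡_ _≡_ position
  position-injective {a} {b} e =
    trans (sym (lookup-index (covered a)))
          (trans (cong (λ k → proj₁ (lookup S k)) e) (lookup-index (covered b)))

module RowCount {n : ℕ} (L : LatinSquare n) (latin : IsLatin L) (r : Fin n) where

  adjacent-outsideRow : ∀ p q → p ≢ r → ∀ j →
    𝟙 (adj? L (r , j) (p , q)) ≤ 𝟙 (j ≟ q) + 𝟙 (L r j ≟ L p q)
  adjacent-outsideRow p q p≢r j with adj? L (r , j) (p , q)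
  ... | no _ = z≤n
  ... | yes (_ , inj₁ r≡p) = ⊥-elim (p≢r (sym r≡p))
  ... | yes (_ , inj₂ (inj₁ j≡q)) with j ≟ q
  ...   | yes _    = s≤s z≤n
  ...   | no  j≢q  = ⊥-elim (j≢q j≡q)
  adjacent-outsideRow p q p≢r j | yes (_ , inj₂ (inj₂ same)) with L r j ≟ L p q
  ...   | yes _    = m≤n+m 1 (𝟙 (j ≟ q))
  ...   | no  diff = ⊥-elim (diff same)

  -- A vertex outside row r has at most two neighbours in row r: one in
  -- its column, and one with its symbol since row r is injective.
  rowContacts≤2 : ∀ p q → p ≢ r → sum (λ j → 𝟙 (adj? L (r , j) (p , q))) ≤ 2
  rowContacts≤2 p q p≢r = begin
    sum (λ j → 𝟙 (adj? L (r , j) (p , q)))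
      ≤⟨ sum-mono (adjacent-outsideRow p q p≢r) ⟩
    sum (λ j → 𝟙 (j ≟ q) + 𝟙 (L r j ≟ L p q))
      ≡⟨ ∑-distrib-+ (λ j → 𝟙 (j ≟ q)) (λ j → 𝟙 (L r j ≟ L p q)) ⟩
    sum (λ j → 𝟙 (j ≟ q)) + sum (λ j → 𝟙 (L r j ≟ L p q))
      ≤⟨ +-mono-≤ (hits-injective≤1 _≟_ (λ j → j) (λ e → e) q)
                  (hits-injective≤1 _≟_ (L r) (proj₁ latin r) (L p q)) ⟩
    2 ∎
    where open ≤-Reasoning

  rowNeighbours≤ : (S : List (Vertex n)) → All (λ s → proj₁ s ≢ r) S →
    sum (λ j → neighboursIn L S (r , j)) ≤ length S * 2
  rowNeighbours≤ [] [] = ≤-reflexive (sum-zero {n} (λ _ → refl))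
  rowNeighbours≤ ((p , q) ∷ S) (p≢r ∷ avoid) = begin
    sum (λ j → neighboursIn L ((p , q) ∷ S) (r , j))
      ≡⟨ sum-cong-≗ (neighboursIn-∷ L (p , q) S ∘ (r ,_)) ⟩
    sum (λ j → 𝟙 (adj? L (r , j) (p , q)) + neighboursIn L S (r , j))
      ≡⟨ ∑-distrib-+ (λ j → 𝟙 (adj? L (r , j) (p , q))) (λ j → neighboursIn L S (r , j)) ⟩
    sum (λ j → 𝟙 (adj? L (r , j) (p , q))) + sum (λ j → neighboursIn L S (r , j))
      ≤⟨ +-mono-≤ (rowContacts≤2 p q p≢r) (rowNeighbours≤ S avoid) ⟩
    2 + length S * 2 ∎
    where open ≤-Reasoning

3n≤2m⇒n≤m : ∀ n m → n * 3 ≤ m * 2 → n ≤ m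
3n≤2m⇒n≤m n m 3n≤2m = *-cancelʳ-≤ n m 3 (≤-trans 3n≤2m (*-monoʳ-≤ m (s≤s (s≤s z≤n))))

-- γ₃(L₃(L,n)) ≥ n.  The argument does not need S to be duplicate-free.
proposition1p4 : (n : ℕ) (L : LatinSquare n) → IsLatin L →
    (S : List (Vertex n)) → Unique S → IsKDominating L 3 S → n ≤ length S
proposition1p4 n L latin S _ dominating with all? (λ r → any? (λ s → proj₁ s ≟ r) S)
... | yes covered = rowsCovered⇒n≤length S covered
... | no notCovered with ¬∀⟶∃¬ n _ (λ r → any? (λ s → proj₁ s ≟ r) S) notCovered
... | r , rowMissed = 3n≤2m⇒n≤m n (length S) (≤-trans threeEach (rowNeighbours≤ S avoid))
  where
  open RowCount L latin r
  avoid : All (λ s → proj₁ s ≢ r) S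
  avoid = ¬Any⇒All¬ S rowMissed
  outside : ∀ j → (r , j) ∉ S
  outside j r,j∈S = rowMissed (Any.map (λ { refl → refl }) r,j∈S)
  threeEach : n * 3 ≤ sum (λ j → neighboursIn L S (r , j))
  threeEach = sum-lowerBound 3 (λ j → dominating (r , j) (outside j))
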